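{- Let $p$ be an odd prime, let $s,t$ be integers with $1 \le s,t \le p-1$, and let $A,B$ be subsets of $\mathbb{Z}_p$ with $|A|=s$, $|B|=t$. Define \[ f(s,t) = \begin{cases} 0 & \text{if } 2t \le p-s+1,\\ \left\lfloor \frac{(s+2t-p)^2}{4}\right\rfloor & \text{if } p-s+2 \le 2t \le p+s-2,\\ s(2t-p) & \text{if } p+s-1 \le 2t,\end{cases} \qquad g(s,t) = \begin{cases} t^2 & \text{if } 2t \le s,\\ \left\lceil \frac{s(4t-s)}{4}\right\rceil & \text{if } s+1 \le 2t \le 2p-s-1,\\ s(2t-p)+(p-t)^2 & \text{if } 2p-s \le 2t.\end{cases} \] Then $f(s,t) \le r(A,B,B) \le g(s,t)$.
   Context: $\mathbb{Z}_p$ is the additive group of integers modulo $p$. $r(A,B,B)$ denotes the number of triples $(a,b,a+b)$ with $a\in A$, $b\in B$ and $a+b\in B$. -}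

module Defs where

open import Data.Nat using (ℕ; zero; suc; _+_; _*_; _∸_; _≤?_; NonZero)
open import Data.Nat.DivMod using (_/_; _mod_)
open import Data.Fin using (Fin; toℕ)
open import Data.Fin.Subset using (Subset; Side; inside; outside)
open import Data.Vec using (lookup)
open import Data.List using (map; allFin)
open import Data.Nat.ListAction using (sum)
open import Data.Bool using (if_then_else_)
open import Relation.Nullary.Decidable using (⌊_⌋)

ind : Side → ℕ
ind inside  = 1
ind outside = 0

_+ₚ_ : ∀ {p} .{{_ : NonZero p}} → Fin p → Fin p → Fin p
_+ₚ_ {p} a b = (toℕ a + toℕ b) mod p

r : ∀ {p} .{{_ : NonZero p}} → Subset p → Subset p → Subset p → ℕ
r {p} A B C = sum (map (λ a → sum (map (λ b →
  ind (lookup A a) * ind (lookup B b) * ind (lookup C (a +ₚ b))) (allFin p))) (allFin p))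

f : ℕ → ℕ → ℕ → ℕ
f p s t =
  if ⌊ 2 * t ≤? p ∸ s + 1 ⌋ then 0
  else if ⌊ 2 * t ≤? p + s ∸ 2 ⌋ then ((s + 2 * t ∸ p) * (s + 2 * t ∸ p)) / 4
  else s * (2 * t ∸ p)

-- g(s,t); ceiling of x/4 written as (x + 3)/4
g : ℕ → ℕ → ℕ → ℕ
g p s t =
  if ⌊ 2 * t ≤? s ⌋ then t * t
  else if ⌊ 2 * t ≤? 2 * p ∸ s ∸ 1 ⌋ then (s * (4 * t ∸ s) + 3) / 4
  else s * (2 * t ∸ p) + (p ∸ t) * (p ∸ t)

module Submission where

-- Let ν(x) be the number of b ∈ B with x + b ∈ B, so that r(A,B,B) = Σ_{a ∈ A} ν(a) and Σ_x ν(x) = t².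
-- Pollard's theorem, Σ_x min(j, ν(x)) ≥ j(2t − j) whenever j ≤ t and 2t − j ≤ p, limits how much of
-- this mass can sit on few points. It is proved for arbitrary pairs (A, B) by induction on |B| via
-- Dyson's e-transform; when no transform shrinks B, A is closed under a nonzero translation and hence,
-- p being prime, is all of ℤ/pℤ. Bounding min(j, ν) by ν on A and by j off A gives
-- r ≥ j(2t − j) − (p − s)j, and ν + min(j, ν) ≤ j + ν on A gives r ≤ sj + t² − j(2t − j). The choices
-- j = 2t − p and j = ⌊(s + 2t − p)/2⌋ yield f, and j = 0, t − ⌊s/2⌋ and 2t − p yield g.

open import Defs
open import Data.Nat using (ℕ; _≤_; _∸_; NonZero)
open import Data.Nat.Primality using (Prime)
open import Data.Nat.Divisibility using (_∣_)
open import Data.Fin.Subset using (Subset; ∣_∣)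
open import Data.Product using (_×_)
open import Relation.Nullary using (¬_)
open import Relation.Binary.PropositionalEquality using (_≡_)

open import Algebra.Bundles using (AbelianGroup)
open import Algebra.Structures using (IsAbelianGroup)
open import Data.Bool using (Bool; true; false; not; _∧_; _∨_)
open import Data.Bool.Properties using (∧-comm)
open import Data.Empty using (⊥-elim)
open import Data.Fin using (Fin; zero; suc; toℕ; punchIn)
open import Data.Fin.Permutation using (permutation)
open import Data.Fin.Properties using (toℕ-injective; toℕ-fromℕ<; toℕ<n; punchInᵢ≢i; any?)
open import Data.List as List using (_∷_; []; tabulate; allFin)
open import Data.List.Properties using (map-tabulate)
open import Data.Nat
  using (zero; suc; _+_; _*_; _<_; _⊓_; _/_; _%_; _≤?_; _<?_; _≟_; z≤n; s≤s; s≤s⁻¹; ≢-nonZero; >-nonZero⁻¹)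
open import Data.Nat.Coprimality using (coprime-Bézout; prime⇒coprime)
open import Data.Nat.DivMod
  using ( _mod_; m%n<n; m≡m%n+[m/n]*n; %-distribˡ-+; %-distribˡ-*; n%n≡0; m*n%n≡0; m<n⇒m%n≡m
        ; [m+n]%n≡m%n; [m+kn]%n≡m%n; m*n/n≡m; /-monoˡ-≤; m<n*o⇒m/o<n)
open import Data.Nat.GCD using (module Bézout)
open import Data.Nat.Induction using (<-rec)
import Data.Nat.ListAction as ListAction
open import Data.Nat.Properties
open import Data.Nat.Tactic.RingSolver using (solve-∀; solve)
open import Data.Product using (∃; ∃-syntax; _,_; proj₁; proj₂)
open import Data.Vec as Vec using (lookup)
open import Function using (_∘_; id)
open import Level using (0ℓ)
open import Relation.Binary.PropositionalEquality
  using (_≢_; refl; sym; trans; cong; cong₂; subst; subst₂; module ≡-Reasoning)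
open import Relation.Binary.PropositionalEquality.Properties using (isEquivalence)
open import Relation.Nullary using (yes; no)
open import Relation.Nullary.Decidable using (_×-dec_)

open import Algebra.Properties.Semiring.Sum +-*-semiring
  using (sum; sum-cong-≗; ∑-distrib-+; ∑-comm; sum-permute; sum-remove; *-distribˡ-sum; *-distribʳ-sum)

-- Finite sums and counting

sum-mono-≤ : ∀ {n} {f g : Fin n → ℕ} → (∀ i → f i ≤ g i) → sum f ≤ sum g
sum-mono-≤ {zero}  f≤g = z≤n
sum-mono-≤ {suc n} f≤g = +-mono-≤ (f≤g zero) (sum-mono-≤ (f≤g ∘ suc))

sum-mono-< : ∀ {n} {f g : Fin n → ℕ} → (∀ i → f i ≤ g i) → ∀ k → f k < g k → sum f < sum g
sum-mono-< f≤g zero    fk<gk = +-mono-<-≤ fk<gk (sum-mono-≤ (f≤g ∘ suc))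
sum-mono-< f≤g (suc k) fk<gk = +-mono-≤-< (f≤g zero) (sum-mono-< (f≤g ∘ suc) k fk<gk)

sum-const : ∀ n c → sum {n} (λ _ → c) ≡ n * c
sum-const zero    c = refl
sum-const (suc n) c = cong (c +_) (sum-const n c)

sum-positive : ∀ {n} (f : Fin n → ℕ) → 0 < sum f → ∃[ i ] 0 < f i
sum-positive {suc n} f 0<Σ with f zero in eq
... | suc _ = zero , subst (0 <_) (sym eq) (s≤s z≤n)
... | zero  = let i , 0<f = sum-positive (f ∘ suc) 0<Σ in suc i , 0<f

sum-reindex : ∀ {n} (h : Fin n → ℕ) (f g : Fin n → Fin n) →
  (∀ x → f (g x) ≡ x) → (∀ x → g (f x) ≡ x) → sum (h ∘ f) ≡ sum h
sum-reindex h f g fg gf = sym (sum-permute h (permutation f g fg gf))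

ind-∧ : ∀ a b → ind (a ∧ b) ≡ ind a * ind b
ind-∧ true  b = sym (+-identityʳ (ind b))
ind-∧ false b = refl

ind-*-≤ˡ : ∀ a b → ind a * ind b ≤ ind a
ind-*-≤ˡ true  true  = s≤s z≤n
ind-*-≤ˡ true  false = z≤n
ind-*-≤ˡ false _     = z≤n

ind-not : ∀ a → ind a + ind (not a) ≡ 1
ind-not true  = refl
ind-not false = refl

ind-∧-not : ∀ a b → ind (a ∧ not b) + ind (a ∧ b) ≡ ind a
ind-∧-not true  true  = refl
ind-∧-not true  false = refl
ind-∧-not false _     = refl

ind-∨ : ∀ a b → ind (a ∨ b) ≡ ind a + ind (not a ∧ b)
ind-∨ true  _ = refl
ind-∨ false _ = refl

count : ∀ {n} → (Fin n → Bool) → ℕ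
count P = sum (ind ∘ P)

count-complement : ∀ {n} (P : Fin n → Bool) → count P + count (not ∘ P) ≡ n
count-complement {n} P = begin
  count P + count (not ∘ P)                 ≡⟨ ∑-distrib-+ (ind ∘ P) (ind ∘ not ∘ P) ⟨
  sum (λ x → ind (P x) + ind (not (P x)))   ≡⟨ sum-cong-≗ (ind-not ∘ P) ⟩
  sum {n} (λ _ → 1)                         ≡⟨ sum-const n 1 ⟩
  n * 1                                     ≡⟨ *-identityʳ n ⟩
  n                                         ∎
  where open ≡-Reasoning

count-witness : ∀ {n} (P : Fin n → Bool) → 0 < count P → ∃[ x ] P x ≡ true
count-witness P 0<count with sum-positive (ind ∘ P) 0<count
... | x , 0<ind with P x in Px
...   | true = x , Px

count-positive : ∀ {n} (P : Fin n → Bool) {x} → P x ≡ true → 0 < count P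
count-positive {n} P {x} Px = subst (_< count P) (trans (sum-const n 0) (*-zeroʳ n))
  (sum-mono-< (λ _ → z≤n) x (subst (λ b → 0 < ind b) (sym Px) (s≤s z≤n)))

count-another : ∀ {n} (P : Fin n → Bool) {x} → P x ≡ true → 2 ≤ count P →
  ∃[ y ] P y ≡ true × y ≢ x
count-another {suc n} P {x} Px 2≤count
  with count-witness (P ∘ punchIn x) (+-cancelˡ-≤ 1 1 _ (subst (2 ≤_) split 2≤count))
  where
  split : count P ≡ 1 + count (P ∘ punchIn x)
  split = trans (sum-remove {i = x} (ind ∘ P)) (cong (λ b → ind b + count (P ∘ punchIn x)) Px)
... | y , Py = punchIn x y , Py , punchInᵢ≢i x y

count≤count-∧⇒⊆ : ∀ {n} (B C : Fin n → Bool) → count B ≤ count (λ x → B x ∧ C x) →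
  ∀ {x} → B x ≡ true → C x ≡ true
count≤count-∧⇒⊆ B C ≤count {x} Bx with C x in Cx
... | true  = refl
... | false = ⊥-elim (<⇒≱ (sum-mono-< ∧≤ x strict) ≤count)
  where
  ∧≤ : ∀ y → ind (B y ∧ C y) ≤ ind (B y)
  ∧≤ y = subst (_≤ ind (B y)) (sym (ind-∧ (B y) (C y))) (ind-*-≤ˡ (B y) (C y))
  strict : ind (B x ∧ C x) < ind (B x)
  strict rewrite Bx | Cx = s≤s z≤n

-- The group ℤ/pℤ

module ℤ/pℤ (p : ℕ) .{{_ : NonZero p}} where

  [_] : ℕ → Fin p
  [ n ] = n mod p

  0ₚ : Fin p
  0ₚ = [ 0 ]

  infix 25 -ₚ_
  -ₚ_ : Fin p → Fin p
  -ₚ a = [ p ∸ toℕ a ]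

  toℕ-[] : ∀ n → toℕ [ n ] ≡ n % p
  toℕ-[] n = toℕ-fromℕ< (m%n<n n p)

  toℕ-0ₚ : toℕ 0ₚ ≡ 0
  toℕ-0ₚ = trans (toℕ-[] 0) (m*n%n≡0 0 p)

  []-cong-% : ∀ {m n} → m % p ≡ n % p → [ m ] ≡ [ n ]
  []-cong-% eq = toℕ-injective (trans (toℕ-[] _) (trans eq (sym (toℕ-[] _))))

  [toℕ] : ∀ a → [ toℕ a ] ≡ a
  [toℕ] a = toℕ-injective (trans (toℕ-[] (toℕ a)) (m<n⇒m%n≡m (toℕ<n a)))

  []-+ : ∀ m n → [ m ] +ₚ [ n ] ≡ [ m + n ]
  []-+ m n = []-cong-% (begin
    (toℕ [ m ] + toℕ [ n ]) % p  ≡⟨ cong₂ (λ x y → (x + y) % p) (toℕ-[] m) (toℕ-[] n) ⟩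
    (m % p + n % p) % p          ≡⟨ %-distribˡ-+ m n p ⟨
    (m + n) % p                  ∎)
    where open ≡-Reasoning

  +ₚ-comm : ∀ a b → a +ₚ b ≡ b +ₚ a
  +ₚ-comm a b = cong [_] (+-comm (toℕ a) (toℕ b))

  +ₚ-assoc : ∀ a b c → (a +ₚ b) +ₚ c ≡ a +ₚ (b +ₚ c)
  +ₚ-assoc a b c = begin
    [ toℕ a + toℕ b ] +ₚ c            ≡⟨ cong ([ toℕ a + toℕ b ] +ₚ_) ([toℕ] c) ⟨
    [ toℕ a + toℕ b ] +ₚ [ toℕ c ]    ≡⟨ []-+ (toℕ a + toℕ b) (toℕ c) ⟩
    [ toℕ a + toℕ b + toℕ c ]         ≡⟨ cong [_] (+-assoc (toℕ a) (toℕ b) (toℕ c)) ⟩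
    [ toℕ a + (toℕ b + toℕ c) ]       ≡⟨ []-+ (toℕ a) (toℕ b + toℕ c) ⟨
    [ toℕ a ] +ₚ [ toℕ b + toℕ c ]    ≡⟨ cong (_+ₚ [ toℕ b + toℕ c ]) ([toℕ] a) ⟩
    a +ₚ (b +ₚ c)                     ∎
    where open ≡-Reasoning

  +ₚ-identityʳ : ∀ a → a +ₚ 0ₚ ≡ a
  +ₚ-identityʳ a = begin
    a +ₚ 0ₚ           ≡⟨ cong (_+ₚ 0ₚ) ([toℕ] a) ⟨
    [ toℕ a ] +ₚ 0ₚ   ≡⟨ []-+ (toℕ a) 0 ⟩
    [ toℕ a + 0 ]     ≡⟨ cong [_] (+-identityʳ (toℕ a)) ⟩
    [ toℕ a ]         ≡⟨ [toℕ] a ⟩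
    a                 ∎
    where open ≡-Reasoning

  +ₚ-inverseʳ : ∀ a → a +ₚ (-ₚ a) ≡ 0ₚ
  +ₚ-inverseʳ a = begin
    a +ₚ (-ₚ a)                 ≡⟨ cong (_+ₚ (-ₚ a)) ([toℕ] a) ⟨
    [ toℕ a ] +ₚ [ p ∸ toℕ a ]  ≡⟨ []-+ (toℕ a) (p ∸ toℕ a) ⟩
    [ toℕ a + (p ∸ toℕ a) ]     ≡⟨ cong [_] (m+[n∸m]≡n (<⇒≤ (toℕ<n a))) ⟩
    [ p ]                       ≡⟨ []-cong-% (trans (n%n≡0 p) (sym (m*n%n≡0 0 p))) ⟩
    0ₚ                          ∎
    where open ≡-Reasoning

  +ₚ-isAbelianGroup : IsAbelianGroup _≡_ _+ₚ_ 0ₚ -ₚ_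
  +ₚ-isAbelianGroup = record
    { isGroup = record
      { isMonoid = record
        { isSemigroup = record
          { isMagma = record { isEquivalence = isEquivalence ; ∙-cong = cong₂ _+ₚ_ }
          ; assoc = +ₚ-assoc
          }
        ; identity = (λ a → trans (+ₚ-comm 0ₚ a) (+ₚ-identityʳ a)) , +ₚ-identityʳ
        }
      ; inverse = (λ a → trans (+ₚ-comm (-ₚ a) a) (+ₚ-inverseʳ a)) , +ₚ-inverseʳ
      ; ⁻¹-cong = cong -ₚ_
      }
    ; comm = +ₚ-comm
    }

  +ₚ-abelianGroup : AbelianGroup 0ℓ 0ℓ
  +ₚ-abelianGroup = record { isAbelianGroup = +ₚ-isAbelianGroup }

  open AbelianGroup +ₚ-abelianGroup public using (_-_)
  open import Algebra.Properties.AbelianGroup +ₚ-abelianGroup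
    using (⁻¹-anti-homo-∙; ⁻¹-anti-homo‿-; xyx⁻¹≈y; //-rightDividesˡ; //-rightDividesʳ; x∙y⁻¹≈ε⇒x≈y)
    public

  reflection-involutive : ∀ e y → e - (e - y) ≡ y
  reflection-involutive e y = begin
    e +ₚ -ₚ (e - y)     ≡⟨ cong (e +ₚ_) (⁻¹-anti-homo‿- e y) ⟩
    e +ₚ (y - e)        ≡⟨ +ₚ-assoc e y (-ₚ e) ⟨
    (e +ₚ y) +ₚ -ₚ e    ≡⟨ xyx⁻¹≈y e y ⟩
    y                   ∎
    where open ≡-Reasoning

  +ₚ-reflection : ∀ x e b → x +ₚ (e - (x +ₚ b)) ≡ e - b
  +ₚ-reflection x e b = begin
    x +ₚ (e +ₚ -ₚ (x +ₚ b))         ≡⟨ cong (λ z → x +ₚ (e +ₚ z)) (⁻¹-anti-homo-∙ x b) ⟩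
    x +ₚ (e +ₚ (-ₚ b +ₚ -ₚ x))      ≡⟨ cong (x +ₚ_) (+ₚ-assoc e (-ₚ b) (-ₚ x)) ⟨
    x +ₚ ((e - b) +ₚ -ₚ x)          ≡⟨ +ₚ-assoc x (e - b) (-ₚ x) ⟨
    (x +ₚ (e - b)) +ₚ -ₚ x          ≡⟨ xyx⁻¹≈y x (e - b) ⟩
    e - b                           ∎
    where open ≡-Reasoning

  sum-translate : ∀ b (h : Fin p → ℕ) → sum (λ x → h (x +ₚ b)) ≡ sum h
  sum-translate b h = sum-reindex h (_+ₚ b) (_- b) (//-rightDividesˡ b) (//-rightDividesʳ b)

  sum-reflect : ∀ e (h : Fin p → ℕ) → sum (λ b → h (e - b)) ≡ sum h
  sum-reflect e h = sum-reindex h (e -_) (e -_) (reflection-involutive e) (reflection-involutive e)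

  shift-iterate : (P : Fin p → Set) (d : Fin p) {a : Fin p} → P a →
    (∀ y → P y → P (y +ₚ d)) → ∀ k → P (a +ₚ [ k * toℕ d ])
  shift-iterate P d {a} Pa closed zero    = subst P (sym (+ₚ-identityʳ a)) Pa
  shift-iterate P d {a} Pa closed (suc k) = subst P shifted
    (closed (a +ₚ [ k * toℕ d ]) (shift-iterate P d Pa closed k))
    where
    shifted : (a +ₚ [ k * toℕ d ]) +ₚ d ≡ a +ₚ [ toℕ d + k * toℕ d ]
    shifted = begin
      (a +ₚ [ k * toℕ d ]) +ₚ d             ≡⟨ +ₚ-assoc a _ d ⟩
      a +ₚ ([ k * toℕ d ] +ₚ d)             ≡⟨ cong (a +ₚ_) (+ₚ-comm _ d) ⟩
      a +ₚ (d +ₚ [ k * toℕ d ])             ≡⟨ cong (λ z → a +ₚ (z +ₚ [ k * toℕ d ])) ([toℕ] d) ⟨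
      a +ₚ ([ toℕ d ] +ₚ [ k * toℕ d ])     ≡⟨ cong (a +ₚ_) ([]-+ (toℕ d) (k * toℕ d)) ⟩
      a +ₚ [ toℕ d + k * toℕ d ]            ∎
      where open ≡-Reasoning

  []-*-unit : ∀ m {c} → c % p ≡ 1 % p → [ m * c ] ≡ [ m ]
  []-*-unit m {c} c≡1 = []-cong-% (begin
    (m * c) % p                ≡⟨ %-distribˡ-* m c p ⟩
    (m % p * (c % p)) % p      ≡⟨ cong (λ z → (m % p * z) % p) c≡1 ⟩
    (m % p * (1 % p)) % p      ≡⟨ %-distribˡ-* m 1 p ⟨
    (m * 1) % p                ≡⟨ cong (_% p) (*-identityʳ m) ⟩
    m % p                      ∎)
    where open ≡-Reasoning

  module _ (p-prime : Prime p) where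

    modular-inverse : ∀ n .{{_ : NonZero n}} → n < p → ∃[ u ] (u * n) % p ≡ 1 % p
    modular-inverse n n<p with coprime-Bézout (prime⇒coprime p-prime n<p)
    ... | Bézout.-+ x y 1+xp≡yn = y , (begin
      (y * n) % p        ≡⟨ cong (_% p) 1+xp≡yn ⟨
      (1 + x * p) % p    ≡⟨ [m+kn]%n≡m%n 1 x p ⟩
      1 % p              ∎)
      where open ≡-Reasoning
    -- here y n ≡ −1, so y (p − 1) inverts n
    ... | Bézout.+- x y 1+yn≡xp = y * (p ∸ 1) , (begin
      (y * (p ∸ 1) * n) % p              ≡⟨ [m+n]%n≡m%n _ p ⟨
      (y * (p ∸ 1) * n + p) % p          ≡⟨ cong (_% p) (negate p (>-nonZero⁻¹ p) 1+yn≡xp) ⟩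
      (1 + x * (p ∸ 1) * p) % p          ≡⟨ [m+kn]%n≡m%n 1 (x * (p ∸ 1)) p ⟩
      1 % p                              ∎)
      where
      open ≡-Reasoning
      negate : ∀ q → 0 < q → 1 + y * n ≡ x * q → y * (q ∸ 1) * n + q ≡ 1 + x * (q ∸ 1) * q
      negate (suc q) _ eq = begin
        y * q * n + suc q       ≡⟨ solve (y ∷ q ∷ n ∷ []) ⟩
        1 + q * (1 + y * n)     ≡⟨ cong (λ z → 1 + q * z) eq ⟩
        1 + q * (x * suc q)     ≡⟨ solve (x ∷ q ∷ []) ⟩
        1 + x * q * suc q       ∎

    closed-under-shift⇒full : (P : Fin p → Set) {a d : Fin p} → d ≢ 0ₚ → P a →
      (∀ y → P y → P (y +ₚ d)) → ∀ x → P x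
    closed-under-shift⇒full P {a} {d} d≢0 Pa closed x =
      subst P hit (shift-iterate P d Pa closed (m * u))
      where
      instance
        d-nonZero : NonZero (toℕ d)
        d-nonZero = ≢-nonZero (λ d≡0 → d≢0 (toℕ-injective (trans d≡0 (sym toℕ-0ₚ))))
      inverse = modular-inverse (toℕ d) (toℕ<n d)
      u = proj₁ inverse
      m = toℕ x + (p ∸ toℕ a)
      hit : a +ₚ [ m * u * toℕ d ] ≡ x
      hit = begin
        a +ₚ [ m * u * toℕ d ]          ≡⟨ cong₂ _+ₚ_ ([toℕ] a) (cong [_] (sym (*-assoc m u (toℕ d)))) ⟨
        [ toℕ a ] +ₚ [ m * (u * toℕ d) ] ≡⟨ cong ([ toℕ a ] +ₚ_) ([]-*-unit m (proj₂ inverse)) ⟩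
        [ toℕ a ] +ₚ [ m ]              ≡⟨ []-+ (toℕ a) m ⟩
        [ toℕ a + m ]                   ≡⟨ cong [_] (+-comm (toℕ a) m) ⟩
        [ toℕ x + (p ∸ toℕ a) + toℕ a ] ≡⟨ cong [_] (+-assoc (toℕ x) _ _) ⟩
        [ toℕ x + (p ∸ toℕ a + toℕ a) ] ≡⟨ cong (λ z → [ toℕ x + z ]) (m∸n+n≡m (<⇒≤ (toℕ<n a))) ⟩
        [ toℕ x + p ]                   ≡⟨ []-cong-% ([m+n]%n≡m%n (toℕ x) p) ⟩
        [ toℕ x ]                       ≡⟨ [toℕ] x ⟩
        x                               ∎
        where open ≡-Reasoning

-- Difference counts and Dyson's e-transform

ind-transform-split : ∀ β α a β′ →
  ind β * ind a + ind β * ind α * ind (not a) * ind β′ ≡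
  ind (β ∧ α) * ind (a ∨ β′) + ind (β ∧ not α) * ind (a ∧ not β′) + ind β * ind (not α) * ind a * ind β′
ind-transform-split false _     _     _     = refl
ind-transform-split true  true  true  _     = refl
ind-transform-split true  true  false true  = refl
ind-transform-split true  true  false false = refl
ind-transform-split true  false true  true  = refl
ind-transform-split true  false true  false = refl
ind-transform-split true  false false _     = refl

module DifferenceCounts (p : ℕ) .{{_ : NonZero p}} where
  open ℤ/pℤ p

  ν : (A B : Fin p → Bool) → Fin p → ℕ
  ν A B x = sum (λ b → ind (B b) * ind (A (x +ₚ b)))

  ν≤count : ∀ A B x → ν A B x ≤ count B
  ν≤count A B x = sum-mono-≤ (λ b → ind-*-≤ˡ (B b) (A (x +ₚ b)))

  sum-ν : ∀ A B → sum (ν A B) ≡ count A * count B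
  sum-ν A B = begin
    sum (λ x → sum (λ b → ind (B b) * ind (A (x +ₚ b))))
      ≡⟨ ∑-comm (λ x b → ind (B b) * ind (A (x +ₚ b))) ⟩
    sum (λ b → sum (λ x → ind (B b) * ind (A (x +ₚ b))))
      ≡⟨ sum-cong-≗ (λ b → *-distribˡ-sum (ind (B b)) (λ x → ind (A (x +ₚ b)))) ⟨
    sum (λ b → ind (B b) * sum (λ x → ind (A (x +ₚ b))))
      ≡⟨ sum-cong-≗ (λ b → cong (ind (B b) *_) (sum-translate b (ind ∘ A))) ⟩
    sum (λ b → ind (B b) * count A)
      ≡⟨ *-distribʳ-sum (count A) (ind ∘ B) ⟨
    count B * count A
      ≡⟨ *-comm (count B) (count A) ⟩
    count A * count B
      ∎
    where open ≡-Reasoning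

  sum-⊓-ν : ∀ A B → sum (λ x → count B ⊓ ν A B x) ≡ count A * count B
  sum-⊓-ν A B = trans (sum-cong-≗ (λ x → m≥n⇒m⊓n≡n (ν≤count A B x))) (sum-ν A B)

  ν-full : ∀ A B → (∀ y → A y ≡ true) → ∀ x → ν A B x ≡ count B
  ν-full A B full x = sum-cong-≗ (λ b → trans (cong (λ a → ind (B b) * ind a) (full (x +ₚ b))) (*-identityʳ (ind (B b))))

  module DysonTransform (A B : Fin p → Bool) (e : Fin p) where

    A∪ A∖ B∩ B∖ : Fin p → Bool
    A∪ y = A y ∨ B (e - y)
    A∖ y = A y ∧ not (B (e - y))
    B∩ b = B b ∧ A (e - b)
    B∖ b = B b ∧ not (A (e - b))

    c : ℕ
    c = count B∩

    ν-split : ∀ x → ν A B x ≡ ν A∪ B∩ x + ν A∖ B∖ x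
    ν-split x = +-cancelʳ-≡ (sum gained) _ _ (begin
      ν A B x + sum gained
        ≡⟨ ∑-distrib-+ (λ b → ind (B b) * ind (A (x +ₚ b))) gained ⟨
      sum (λ b → ind (B b) * ind (A (x +ₚ b)) + gained b)
        ≡⟨ sum-cong-≗ (λ b → ind-transform-split (B b) (A (e - b)) (A (x +ₚ b)) (B (σ b))) ⟩
      sum (λ b → ind (B∩ b) * ind (A∪ (x +ₚ b)) + ind (B∖ b) * ind (A∖ (x +ₚ b)) + lost b)
        ≡⟨ ∑-distrib-+ (λ b → ind (B∩ b) * ind (A∪ (x +ₚ b)) + ind (B∖ b) * ind (A∖ (x +ₚ b))) lost ⟩
      sum (λ b → ind (B∩ b) * ind (A∪ (x +ₚ b)) + ind (B∖ b) * ind (A∖ (x +ₚ b))) + sum lost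
        ≡⟨ cong₂ _+_ (∑-distrib-+ (λ b → ind (B∩ b) * ind (A∪ (x +ₚ b))) (λ b → ind (B∖ b) * ind (A∖ (x +ₚ b))))
                     lost≡gained ⟩
      ν A∪ B∩ x + ν A∖ B∖ x + sum gained
        ∎)
      where
      open ≡-Reasoning
      σ : Fin p → Fin p
      σ b = e - (x +ₚ b)
      gained lost : Fin p → ℕ
      gained b = ind (B b) * ind (A (e - b)) * ind (not (A (x +ₚ b))) * ind (B (σ b))
      lost b   = ind (B b) * ind (not (A (e - b))) * ind (A (x +ₚ b)) * ind (B (σ b))
      -- σ is an involution exchanging the lost and the gained summands
      lost∘σ : ∀ b → lost (σ b) ≡ gained b
      lost∘σ b rewrite +ₚ-reflection x e b | reflection-involutive e (x +ₚ b) | reflection-involutive e b =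
        reverse (ind (B (σ b))) (ind (not (A (x +ₚ b)))) (ind (A (e - b))) (ind (B b))
        where
        reverse : ∀ a b c d → a * b * c * d ≡ d * c * b * a
        reverse = solve-∀
      lost≡gained : sum lost ≡ sum gained
      lost≡gained = trans (sym (sum-reindex lost σ σ involutive involutive)) (sum-cong-≗ lost∘σ)
        where
        involutive : ∀ b → σ (σ b) ≡ b
        involutive b = trans (cong (e -_) (+ₚ-reflection x e b)) (reflection-involutive e b)

    count-reflect : ∀ (P Q : Fin p → Bool) → count (λ y → P y ∧ Q (e - y)) ≡ count (λ b → Q b ∧ P (e - b))
    count-reflect P Q = begin
      count (λ y → P y ∧ Q (e - y))                 ≡⟨ sum-reflect e (λ y → ind (P y ∧ Q (e - y))) ⟨
      sum (λ b → ind (P (e - b) ∧ Q (e - (e - b))))  ≡⟨ sum-cong-≗ (λ b → cong ind (trans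
                                                         (cong (λ z → P (e - b) ∧ Q z) (reflection-involutive e b))
                                                         (∧-comm (P (e - b)) (Q b)))) ⟩
      count (λ b → Q b ∧ P (e - b))                 ∎
      where open ≡-Reasoning

    count-B∖ : count B∖ + c ≡ count B
    count-B∖ = trans (sym (∑-distrib-+ (ind ∘ B∖) (ind ∘ B∩))) (sum-cong-≗ (λ b → ind-∧-not (B b) (A (e - b))))

    count-A∖ : count A∖ + c ≡ count A
    count-A∖ = begin
      count A∖ + c                                   ≡⟨ cong (count A∖ +_) (count-reflect A B) ⟨
      count A∖ + count (λ y → A y ∧ B (e - y))       ≡⟨ ∑-distrib-+ (ind ∘ A∖) (λ y → ind (A y ∧ B (e - y))) ⟨
      sum (λ y → ind (A∖ y) + ind (A y ∧ B (e - y))) ≡⟨ sum-cong-≗ (λ y → ind-∧-not (A y) (B (e - y))) ⟩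
      count A                                        ∎
      where open ≡-Reasoning

    count-A∪ : count A∪ ≡ count A + count B∖
    count-A∪ = begin
      count A∪                                              ≡⟨ sum-cong-≗ (λ y → ind-∨ (A y) (B (e - y))) ⟩
      sum (λ y → ind (A y) + ind (not (A y) ∧ B (e - y)))   ≡⟨ ∑-distrib-+ (ind ∘ A) (λ y → ind (not (A y) ∧ B (e - y))) ⟩
      count A + count (λ y → not (A y) ∧ B (e - y))         ≡⟨ cong (count A +_) (count-reflect (not ∘ A) B) ⟩
      count A + count B∖                                    ∎
      where open ≡-Reasoning

    count-preserved : count A∪ + c ≡ count A + count B
    count-preserved = begin
      count A∪ + c               ≡⟨ cong (_+ c) count-A∪ ⟩
      count A + count B∖ + c     ≡⟨ +-assoc (count A) (count B∖) c ⟩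
      count A + (count B∖ + c)   ≡⟨ cong (count A +_) count-B∖ ⟩
      count A + count B          ∎
      where open ≡-Reasoning

-- Pollard's theorem

+-⊓-≤ : ∀ {a b c j} → a ≤ c → c ≤ j → a + (j ∸ c) ⊓ b ≤ j ⊓ (a + b)
+-⊓-≤ {a} {b} {c} {j} a≤c c≤j = begin
  a + (j ∸ c) ⊓ b          ≡⟨ +-distribˡ-⊓ a (j ∸ c) b ⟩
  (a + (j ∸ c)) ⊓ (a + b)  ≤⟨ ⊓-monoˡ-≤ (a + b) (≤-trans (+-monoˡ-≤ (j ∸ c) a≤c) (≤-reflexive (m+[n∸m]≡n c≤j))) ⟩
  j ⊓ (a + b)              ∎
  where open ≤-Reasoning

-- the arithmetic of the case c ≤ j of Pollard's induction, with S j′ the bound supplied by the induction hypothesis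
pollard-split-arithmetic : ∀ {α β c j k} (S : ℕ → ℕ) →
  c ≤ j → j ≤ α + c → j ≤ β + c → j + k ≡ (α + c) + (β + c) →
  (∀ j′ k′ → j′ ≤ α → j′ ≤ β → j′ + k′ ≡ α + β → k′ ≤ k → j′ * k′ ≤ S j′) →
  j * k ≤ (α + c + β) * c + S (j ∸ c)
pollard-split-arithmetic {α} {β} {c} {j} {k} S c≤j j≤α+c j≤β+c j+k≡ ih with m≤n⇒∃[o]m+o≡n c≤j
... | j′ , refl with m≤n⇒∃[o]m+o≡n (+-cancelˡ-≤ c j′ α (subst (c + j′ ≤_) (+-comm α c) j≤α+c))
... | a , refl rewrite m+n∸m≡n c j′ = begin
  (c + j′) * k                            ≡⟨ cong ((c + j′) *_) k≡ ⟩
  (c + j′) * (a + β + c)                  ≡⟨ solve (c ∷ j′ ∷ a ∷ β ∷ []) ⟩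
  (j′ + a + c + β) * c + j′ * (a + β)      ≤⟨ +-monoʳ-≤ ((j′ + a + c + β) * c) (ih j′ (a + β) (m≤m+n j′ a) j′≤β
                                               (sym (+-assoc j′ a β)) (subst (a + β ≤_) (sym k≡) (m≤m+n (a + β) c))) ⟩
  (j′ + a + c + β) * c + S j′              ∎
  where
  open ≤-Reasoning
  j′≤β : j′ ≤ β
  j′≤β = +-cancelˡ-≤ c j′ β (subst (c + j′ ≤_) (+-comm β c) j≤β+c)
  k≡ : k ≡ a + β + c
  k≡ = +-cancelˡ-≡ (c + j′) k (a + β + c) (trans j+k≡ (solve (c ∷ j′ ∷ a ∷ β ∷ [])))

module Pollard (p : ℕ) .{{_ : NonZero p}} (p-prime : Prime p) where
  open ℤ/pℤ p
  open DifferenceCounts p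

  PollardBound : (A B : Fin p → Bool) → Set
  PollardBound A B = ∀ j k → j ≤ count A → j ≤ count B → j + k ≡ count A + count B → k ≤ p →
    j * k ≤ sum (λ x → j ⊓ ν A B x)

  pollard-saturated : ∀ A B k → count B + k ≡ count A + count B →
    count B * k ≤ sum (λ x → count B ⊓ ν A B x)
  pollard-saturated A B k eq = ≤-reflexive (begin
    count B * k        ≡⟨ cong (count B *_) (+-cancelˡ-≡ (count B) k (count A) (trans eq (+-comm (count A) (count B)))) ⟩
    count B * count A  ≡⟨ *-comm (count B) (count A) ⟩
    count A * count B  ≡⟨ sum-⊓-ν A B ⟨
    sum (λ x → count B ⊓ ν A B x) ∎)
    where open ≡-Reasoning

  pollard-full : ∀ A B j k → (∀ y → A y ≡ true) → j ≤ count B → k ≤ p → j * k ≤ sum (λ x → j ⊓ ν A B x)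
  pollard-full A B j k full j≤B k≤p = begin
    j * k                          ≤⟨ *-monoʳ-≤ j k≤p ⟩
    j * p                          ≡⟨ *-comm j p ⟩
    p * j                          ≡⟨ sum-const p j ⟨
    sum {p} (λ _ → j)              ≡⟨ sum-cong-≗ (λ x → trans (cong (j ⊓_) (ν-full A B full x)) (m≤n⇒m⊓n≡m j≤B)) ⟨
    sum (λ x → j ⊓ ν A B x)        ∎
    where open ≤-Reasoning

  -- if no Dyson transform shrinks B, then B ⊆ (y + b₀) − A for all y ∈ A, so A is closed under adding b₀ − b₁
  untransformable⇒full : ∀ A B → (∀ e → 0 < DysonTransform.c A B e → count B ≤ DysonTransform.c A B e) →
    0 < count A → 2 ≤ count B → ∀ x → A x ≡ true
  untransformable⇒full A B untransformable 0<A 2≤B =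
    closed-under-shift⇒full p-prime (λ y → A y ≡ true) b₀-b₁≢0 (proj₂ a∈A) closed
    where
    a∈A = count-witness A 0<A
    b₀∈B = count-witness B (≤-trans (s≤s z≤n) 2≤B)
    b₀ = proj₁ b₀∈B
    b₁∈B = count-another B (proj₂ b₀∈B) 2≤B
    b₁ = proj₁ b₁∈B
    b₀-b₁≢0 : b₀ - b₁ ≢ 0ₚ
    b₀-b₁≢0 eq = proj₂ (proj₂ b₁∈B) (sym (x∙y⁻¹≈ε⇒x≈y b₀ b₁ eq))
    closed : ∀ y → A y ≡ true → A (y +ₚ (b₀ - b₁)) ≡ true
    closed y Ay = subst (λ z → A z ≡ true) (+ₚ-assoc y b₀ (-ₚ b₁))
      (count≤count-∧⇒⊆ B (λ b → A (e - b)) (untransformable e 0<c) (proj₁ (proj₂ b₁∈B)))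
      where
      e = y +ₚ b₀
      open DysonTransform A B e
      0<c : 0 < c
      0<c = count-positive B∩ (subst₂ (λ β a → β ∧ A a ≡ true) (sym (proj₂ b₀∈B)) (sym (//-rightDividesʳ b₀ y)) Ay)

  module _ (A B : Fin p → Bool) (e : Fin p) {j k : ℕ} where
    open DysonTransform A B e

    pollard-transform-≤ : j ≤ c → PollardBound A∪ B∩ → j ≤ count A → j + k ≡ count A + count B → k ≤ p →
      j * k ≤ sum (λ x → j ⊓ ν A B x)
    pollard-transform-≤ j≤c ih j≤A j+k≡ k≤p = begin
      j * k                          ≤⟨ ih j k j≤A∪ j≤c (trans j+k≡ (sym count-preserved)) k≤p ⟩
      sum (λ x → j ⊓ ν A∪ B∩ x)      ≤⟨ sum-mono-≤ (λ x → ⊓-monoʳ-≤ j (ν∪≤ν x)) ⟩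
      sum (λ x → j ⊓ ν A B x)        ∎
      where
      open ≤-Reasoning
      ν∪≤ν : ∀ x → ν A∪ B∩ x ≤ ν A B x
      ν∪≤ν x = subst (ν A∪ B∩ x ≤_) (sym (ν-split x)) (m≤m+n (ν A∪ B∩ x) (ν A∖ B∖ x))
      j≤A∪ : j ≤ count A∪
      j≤A∪ = ≤-trans j≤A (subst (count A ≤_) (sym count-A∪) (m≤m+n (count A) (count B∖)))

    pollard-transform-≥ : c ≤ j → PollardBound A∖ B∖ → j ≤ count A → j ≤ count B →
      j + k ≡ count A + count B → k ≤ p → j * k ≤ sum (λ x → j ⊓ ν A B x)
    pollard-transform-≥ c≤j ih j≤A j≤B j+k≡ k≤p = begin
      j * k
        ≤⟨ pollard-split-arithmetic (λ j′ → sum (λ x → j′ ⊓ ν A∖ B∖ x)) c≤j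
             (subst (j ≤_) (sym count-A∖) j≤A) (subst (j ≤_) (sym count-B∖) j≤B)
             (trans j+k≡ (sym (cong₂ _+_ count-A∖ count-B∖)))
             (λ j′ k′ j′≤α j′≤β eq k′≤k → ih j′ k′ j′≤α j′≤β eq (≤-trans k′≤k k≤p)) ⟩
      (count A∖ + c + count B∖) * c + sum (λ x → (j ∸ c) ⊓ ν A∖ B∖ x)
        ≡⟨ cong (λ a → a * c + sum (λ x → (j ∸ c) ⊓ ν A∖ B∖ x))
             (trans (cong (_+ count B∖) count-A∖) (sym count-A∪)) ⟩
      count A∪ * c + sum (λ x → (j ∸ c) ⊓ ν A∖ B∖ x)
        ≡⟨ cong (_+ sum (λ x → (j ∸ c) ⊓ ν A∖ B∖ x)) (sum-ν A∪ B∩) ⟨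
      sum (ν A∪ B∩) + sum (λ x → (j ∸ c) ⊓ ν A∖ B∖ x)
        ≡⟨ ∑-distrib-+ (ν A∪ B∩) (λ x → (j ∸ c) ⊓ ν A∖ B∖ x) ⟨
      sum (λ x → ν A∪ B∩ x + (j ∸ c) ⊓ ν A∖ B∖ x)
        ≤⟨ sum-mono-≤ (λ x → subst (λ n → ν A∪ B∩ x + (j ∸ c) ⊓ ν A∖ B∖ x ≤ j ⊓ n) (sym (ν-split x))
             (+-⊓-≤ (ν≤count A∪ B∩ x) c≤j)) ⟩
      sum (λ x → j ⊓ ν A B x)
        ∎
      where open ≤-Reasoning

  pollard-step : ∀ A B → (∀ A′ B′ → count B′ < count B → PollardBound A′ B′) → PollardBound A B
  pollard-step A B ih zero k _ _ _ _ = z≤n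
  pollard-step A B ih (suc j) k j≤A j≤B j+k≡ k≤p with suc j ≟ count B
  ... | yes j≡B = subst (λ i → i * k ≤ sum (λ x → i ⊓ ν A B x)) (sym j≡B)
                    (pollard-saturated A B k (subst (λ i → i + k ≡ count A + count B) j≡B j+k≡))
  ... | no j≢B with any? (λ e → 0 <? DysonTransform.c A B e ×-dec DysonTransform.c A B e <? count B)
  ...   | yes (e , 0<c , c<B) with suc j ≤? DysonTransform.c A B e
  ...     | yes j≤c = pollard-transform-≤ A B e j≤c (ih _ _ c<B) j≤A j+k≡ k≤p
  ...     | no  j≰c = pollard-transform-≥ A B e (<⇒≤ (≰⇒> j≰c)) (ih _ _ B∖<B) j≤A j≤B j+k≡ k≤p
    where
    open DysonTransform A B e
    B∖<B : count B∖ < count B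
    B∖<B = subst (count B∖ <_) count-B∖ (subst (_≤ count B∖ + c) (+-comm (count B∖) 1) (+-monoʳ-≤ (count B∖) 0<c))
  pollard-step A B ih (suc j) k j≤A j≤B j+k≡ k≤p | no j≢B | no untransformable =
    pollard-full A B (suc j) k full j≤B k≤p
    where
    full = untransformable⇒full A B (λ e 0<c → ≮⇒≥ (λ c<B → untransformable (e , 0<c , c<B)))
             (≤-trans (s≤s z≤n) j≤A) (≤-trans (s≤s (s≤s z≤n)) (≤∧≢⇒< j≤B j≢B))

  pollard : ∀ A B → PollardBound A B
  pollard A B = <-rec (λ n → ∀ A B → count B ≡ n → PollardBound A B)
    (λ n ih A B B≡n → pollard-step A B (λ A′ B′ B′<B → ih (subst (count B′ <_) B≡n B′<B) A′ B′ refl))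
    (count B) A B refl

-- Optimising over j

-- the bounds on R = r(A,B,B), |A| = s, |B| = t, |ℤ/pℤ ∖ A| = q, given by Pollard's theorem for each admissible 2t = j + k
UpperBounds : (p s t R : ℕ) → Set
UpperBounds p s t R = ∀ j k → j ≤ t → j + k ≡ 2 * t → k ≤ p → R + j * k ≤ s * j + t * t

LowerBounds : (p q t R : ℕ) → Set
LowerBounds p q t R = ∀ j k → j ≤ t → j + k ≡ 2 * t → k ≤ p → j * k ≤ R + q * j

≤∸⇒+≤ : ∀ {m n o} → o ≤ n → m ≤ n ∸ o → m + o ≤ n
≤∸⇒+≤ {o = o} o≤n m≤n∸o = ≤-trans (+-monoˡ-≤ o m≤n∸o) (≤-reflexive (m∸n+n≡m o≤n))

∸<⇒<+ : ∀ {m n o} → m ∸ n < o → m < n + o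
∸<⇒<+ {m} {n} m∸n<o = ≤-<-trans (m≤n+m∸n m n) (+-monoʳ-< n m∸n<o)

halve : ∀ {m n} → m * 2 ≤ n * 2 → m ≤ n
halve {m} {n} = *-cancelʳ-≤ m n 2

parity : ∀ n → ∃ λ ε → ∃ λ h → ε ≤ 1 × n ≡ ε + h * 2
parity n = n % 2 , n / 2 , s≤s⁻¹ (m%n<n n 2) , m≡m%n+[m/n]*n n 2

*-≤⇒≤/ : ∀ {m n} o .{{_ : NonZero o}} → m * o ≤ n → m ≤ n / o
*-≤⇒≤/ {m} {n} o m*o≤n = subst (_≤ n / o) (m*n/n≡m m o) (/-monoˡ-≤ o m*o≤n)

<*⇒/≤ : ∀ {m n} o .{{_ : NonZero o}} → m < suc n * o → m / o ≤ n
<*⇒/≤ o m<n*o = s≤s⁻¹ (m<n*o⇒m/o<n m<n*o)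

upper-small : ∀ {p s t R} → 2 * t ≤ p → UpperBounds p s t R → R ≤ t * t
upper-small {s = s} {t} {R} 2t≤p upper = subst₂ _≤_ (+-identityʳ R) (cong (_+ t * t) (*-zeroʳ s))
  (upper 0 (2 * t) z≤n refl 2t≤p)

large-splitting : ∀ {p t} → p ≤ 2 * t → t ≤ p → 2 * t ∸ p ≤ t × (2 * t ∸ p) + p ≡ 2 * t
large-splitting {p} {t} p≤2t t≤p =
  m≤n+o⇒m∸n≤o (2 * t) p (subst (_≤ p + t) (cong (t +_) (sym (+-identityʳ t))) (+-monoˡ-≤ t t≤p)) ,
  m∸n+n≡m p≤2t

square-split : ∀ {p t} → p ≤ 2 * t → t ≤ p → t * t ≡ (p ∸ t) * (p ∸ t) + (2 * t ∸ p) * p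
square-split {p} {t} p≤2t t≤p with m≤n⇒∃[o]m+o≡n t≤p
... | w , refl with m≤n⇒∃[o]m+o≡n (+-cancelˡ-≤ t w t (subst (t + w ≤_) (cong (t +_) (+-identityʳ t)) p≤2t))
... | j , refl = begin
  (w + j) * (w + j)                   ≡⟨ solve (w ∷ j ∷ []) ⟩
  w * w + j * (w + j + w)             ≡⟨ cong₂ (λ a b → a * a + b * (w + j + w)) (m+n∸m≡n (w + j) w) 2t∸p ⟨
  (w + j + w ∸ (w + j)) * (w + j + w ∸ (w + j)) + (2 * (w + j) ∸ (w + j + w)) * (w + j + w) ∎
  where
  open ≡-Reasoning
  2t∸p : 2 * (w + j) ∸ (w + j + w) ≡ j
  2t∸p = trans (cong (_∸ (w + j + w)) 2t≡p+j) (m+n∸m≡n (w + j + w) j)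
    where
    2t≡p+j : 2 * (w + j) ≡ w + j + w + j
    2t≡p+j = solve (w ∷ j ∷ [])

upper-large : ∀ {p s t R} → p ≤ 2 * t → t ≤ p → UpperBounds p s t R → R ≤ s * (2 * t ∸ p) + (p ∸ t) * (p ∸ t)
upper-large {p} {s} {t} {R} p≤2t t≤p upper = +-cancelʳ-≤ ((2 * t ∸ p) * p) R _ (begin
  R + (2 * t ∸ p) * p                                       ≤⟨ upper (2 * t ∸ p) p j≤t j+p≡2t ≤-refl ⟩
  s * (2 * t ∸ p) + t * t                                   ≡⟨ cong (s * (2 * t ∸ p) +_) (square-split p≤2t t≤p) ⟩
  s * (2 * t ∸ p) + ((p ∸ t) * (p ∸ t) + (2 * t ∸ p) * p)   ≡⟨ +-assoc (s * (2 * t ∸ p)) _ _ ⟨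
  s * (2 * t ∸ p) + (p ∸ t) * (p ∸ t) + (2 * t ∸ p) * p     ∎)
  where
  open ≤-Reasoning
  j≤t = proj₁ (large-splitting p≤2t t≤p)
  j+p≡2t = proj₂ (large-splitting p≤2t t≤p)

lower-large : ∀ {p q s t R} → s + q ≡ p → p ≤ 2 * t → t ≤ p → LowerBounds p q t R → s * (2 * t ∸ p) ≤ R
lower-large {q = q} {s} {t} {R} refl p≤2t t≤p lower = +-cancelʳ-≤ (q * j) (s * j) R (begin
  s * j + q * j       ≡⟨ *-distribʳ-+ j s q ⟨
  (s + q) * j         ≡⟨ *-comm (s + q) j ⟩
  j * (s + q)         ≤⟨ lower j (s + q) j≤t j+p≡2t ≤-refl ⟩
  R + q * j           ∎)
  where
  open ≤-Reasoning
  j = 2 * t ∸ (s + q)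
  j≤t = proj₁ (large-splitting p≤2t t≤p)
  j+p≡2t = proj₂ (large-splitting p≤2t t≤p)

quarter-ceil : ∀ {s t R} → s ≤ 4 * t → R * 4 + s * s ≤ s * (4 * t) + 3 → R ≤ (s * (4 * t ∸ s) + 3) / 4
quarter-ceil {s} {t} {R} s≤4t bound = *-≤⇒≤/ 4 (+-cancelʳ-≤ (s * s) (R * 4) _ (begin
  R * 4 + s * s                 ≤⟨ bound ⟩
  s * (4 * t) + 3               ≡⟨ cong (λ n → s * n + 3) (m∸n+n≡m s≤4t) ⟨
  s * (4 * t ∸ s + s) + 3       ≡⟨ cong (_+ 3) (*-distribˡ-+ s (4 * t ∸ s) s) ⟩
  s * (4 * t ∸ s) + s * s + 3   ≡⟨ +-assoc (s * (4 * t ∸ s)) (s * s) 3 ⟩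
  s * (4 * t ∸ s) + (s * s + 3) ≡⟨ cong (s * (4 * t ∸ s) +_) (+-comm (s * s) 3) ⟩
  s * (4 * t ∸ s) + (3 + s * s) ≡⟨ +-assoc (s * (4 * t ∸ s)) 3 (s * s) ⟨
  s * (4 * t ∸ s) + 3 + s * s   ∎))
  where open ≤-Reasoning

-- s = ε + 2h, t = h + i: the bound at j = i, k = t + h
upper-middle-bound : ∀ {ε h i R} → ε ≤ 1 →
  R + i * (h + i + h) ≤ (ε + h * 2) * i + (h + i) * (h + i) →
  R * 4 + (ε + h * 2) * (ε + h * 2) ≤ (ε + h * 2) * (4 * (h + i)) + 3
upper-middle-bound {ε} {h} {i} {R} ε≤1 bound = +-cancelʳ-≤ (i * (h + i + h) * 4) _ _ (begin
  R * 4 + s * s + i * (h + i + h) * 4          ≡⟨ regroup R (s * s) (i * (h + i + h)) ⟩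
  (R + i * (h + i + h)) * 4 + s * s            ≤⟨ +-monoˡ-≤ (s * s) (*-monoˡ-≤ 4 bound) ⟩
  (s * i + (h + i) * (h + i)) * 4 + s * s      ≡⟨ expand ε h i ⟩
  s * (4 * (h + i)) + ε * ε + i * (h + i + h) * 4
    ≤⟨ +-monoˡ-≤ (i * (h + i + h) * 4) (+-monoʳ-≤ (s * (4 * (h + i))) ε²≤3) ⟩
  s * (4 * (h + i)) + 3 + i * (h + i + h) * 4  ∎)
  where
  open ≤-Reasoning
  s = ε + h * 2
  expand : ∀ ε h i → ((ε + h * 2) * i + (h + i) * (h + i)) * 4 + (ε + h * 2) * (ε + h * 2) ≡
                     (ε + h * 2) * (4 * (h + i)) + ε * ε + i * (h + i + h) * 4
  expand = solve-∀
  regroup : ∀ R S X → R * 4 + S + X * 4 ≡ (R + X) * 4 + S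
  regroup = solve-∀
  ε²≤3 : ε * ε ≤ 3
  ε²≤3 = ≤-trans (*-mono-≤ ε≤1 ε≤1) (s≤s z≤n)

upper-middle : ∀ {p s t R} → s < 2 * t → 2 * t + s ≤ 2 * p → UpperBounds p s t R → R ≤ (s * (4 * t ∸ s) + 3) / 4
upper-middle {p} {s} {t} {R} s<2t 2t+s≤2p upper with parity s
... | ε , h , ε≤1 , s≡
    with m≤n⇒∃[o]m+o≡n {h} {t} (halve (≤-trans (≤-trans (m≤n+m (h * 2) ε) (≤-reflexive (sym s≡)))
                                         (≤-trans (<⇒≤ s<2t) (≤-reflexive (*-comm 2 t)))))
... | i , refl = quarter-ceil {s} {h + i} s≤4t (subst (λ n → R * 4 + n * n ≤ n * (4 * (h + i)) + 3) (sym s≡)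
  (upper-middle-bound {ε} {h} {i} ε≤1 (subst (λ n → R + i * (h + i + h) ≤ n * i + (h + i) * (h + i)) s≡
    (upper i (h + i + h) (m≤n+m i h) split k≤p))))
  where
  split : i + (h + i + h) ≡ 2 * (h + i)
  split = solve (h ∷ i ∷ [])
  s≤4t : s ≤ 4 * (h + i)
  s≤4t = ≤-trans (<⇒≤ s<2t) (*-monoˡ-≤ (h + i) {2} {4} (s≤s (s≤s z≤n)))
  k≤p : h + i + h ≤ p
  k≤p = *-cancelˡ-≤ 2 (begin
    2 * (h + i + h)      ≡⟨ solve (h ∷ i ∷ []) ⟩
    2 * (h + i) + h * 2  ≤⟨ +-monoʳ-≤ (2 * (h + i)) (subst (h * 2 ≤_) (sym s≡) (m≤n+m (h * 2) ε)) ⟩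
    2 * (h + i) + s      ≤⟨ 2t+s≤2p ⟩
    2 * p                ∎)
    where open ≤-Reasoning

-- 2t − q = ε + 2h: the bound at j = h, k = q + h + ε
lower-middle-bound : ∀ {ε h q R} → ε ≤ 1 → h * (q + (h + ε)) ≤ R + q * h → (ε + h * 2) * (ε + h * 2) < suc R * 4
lower-middle-bound {ε} {h} {q} {R} ε≤1 bound = begin-strict
  (ε + h * 2) * (ε + h * 2)   ≡⟨ square ε h ⟩
  h * (h + ε) * 4 + ε * ε     ≤⟨ +-mono-≤ (*-monoˡ-≤ 4 h[h+ε]≤R) (*-mono-≤ ε≤1 ε≤1) ⟩
  R * 4 + 1                   <⟨ +-monoʳ-< (R * 4) (s≤s (s≤s z≤n)) ⟩
  R * 4 + 4                   ≡⟨ +-comm (R * 4) 4 ⟩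
  suc R * 4                   ∎
  where
  open ≤-Reasoning
  square : ∀ ε h → (ε + h * 2) * (ε + h * 2) ≡ h * (h + ε) * 4 + ε * ε
  square = solve-∀
  h[h+ε]≤R : h * (h + ε) ≤ R
  h[h+ε]≤R = +-cancelˡ-≤ (q * h) (h * (h + ε)) R (begin
    q * h + h * (h + ε)   ≡⟨ trans (*-distribˡ-+ h q (h + ε)) (cong (_+ h * (h + ε)) (*-comm h q)) ⟨
    h * (q + (h + ε))     ≤⟨ bound ⟩
    R + q * h             ≡⟨ +-comm R (q * h) ⟩
    q * h + R             ∎)

lower-middle : ∀ {p q s t R} → s + q ≡ p → q ≤ 2 * t → 2 * t + 2 ≤ p + s → LowerBounds p q t R →
  ((s + 2 * t ∸ p) * (s + 2 * t ∸ p)) / 4 ≤ R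
lower-middle {q = q} {s} {t} {R} refl q≤2t 2t+2≤p+s lower with parity (2 * t ∸ q)
... | ε , h , ε≤1 , m≡ = subst (λ n → (n * n) / 4 ≤ R) (sym (trans ([m+n]∸[m+o]≡n∸o s (2 * t) q) m≡))
  (<*⇒/≤ 4 (lower-middle-bound {ε} {h} {q} {R} ε≤1 (lower h (q + (h + ε)) h≤t split k≤p)))
  where
  q+m≡2t : q + (ε + h * 2) ≡ 2 * t
  q+m≡2t = trans (cong (q +_) (sym m≡)) (m+[n∸m]≡n q≤2t)
  h≤t : h ≤ t
  h≤t = halve (+-cancelˡ-≤ q (h * 2) (t * 2) (begin
    q + h * 2          ≤⟨ +-monoʳ-≤ q (m≤n+m (h * 2) ε) ⟩
    q + (ε + h * 2)    ≡⟨ trans q+m≡2t (*-comm 2 t) ⟩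
    t * 2              ≤⟨ m≤n+m (t * 2) q ⟩
    q + t * 2          ∎))
    where open ≤-Reasoning
  split : h + (q + (h + ε)) ≡ 2 * t
  split = trans (rearrange h q ε) q+m≡2t
    where
    rearrange : ∀ h q ε → h + (q + (h + ε)) ≡ q + (ε + h * 2)
    rearrange = solve-∀
  k≤p : q + (h + ε) ≤ s + q
  k≤p = subst (q + (h + ε) ≤_) (+-comm q s) (+-monoʳ-≤ q (halve (+-cancelˡ-≤ q ((h + ε) * 2) (s * 2) (begin
    q + (h + ε) * 2          ≡⟨ double q h ε ⟩
    q + (ε + h * 2) + ε      ≤⟨ +-monoʳ-≤ (q + (ε + h * 2)) (≤-trans ε≤1 (s≤s z≤n)) ⟩
    q + (ε + h * 2) + 2      ≡⟨ cong (_+ 2) q+m≡2t ⟩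
    2 * t + 2                ≤⟨ 2t+2≤p+s ⟩
    s + q + s                ≡⟨ regroup s q ⟩
    q + s * 2                ∎))))
    where
    open ≤-Reasoning
    double : ∀ q h ε → q + (h + ε) * 2 ≡ q + (ε + h * 2) + ε
    double = solve-∀
    regroup : ∀ s q → s + q + s ≡ q + s * 2
    regroup = solve-∀

g-upper : ∀ {p s t R} → s < p → t ≤ p → UpperBounds p s t R → R ≤ g p s t
g-upper {p} {s} {t} s<p t≤p upper with 2 * t ≤? s
... | yes 2t≤s = upper-small {s = s} (≤-trans 2t≤s (<⇒≤ s<p)) upper
... | no 2t≰s with 2 * t ≤? 2 * p ∸ s ∸ 1
...   | yes 2t≤2p-s-1 =
  upper-middle {s = s} (≰⇒> 2t≰s) (≤∸⇒+≤ s≤2p (≤-trans 2t≤2p-s-1 (m∸n≤m (2 * p ∸ s) 1))) upper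
  where
  s≤2p : s ≤ 2 * p
  s≤2p = ≤-trans (<⇒≤ s<p) (m≤m+n p (p + 0))
...   | no 2t≰2p-s-1 = upper-large {s = s} (<⇒≤ (≤-<-trans p≤2p-s-1 (≰⇒> 2t≰2p-s-1))) t≤p upper
  where
  p≤2p-s-1 : p ≤ 2 * p ∸ s ∸ 1
  p≤2p-s-1 = m+n≤o⇒m≤o∸n p (m+n≤o⇒m≤o∸n (p + 1) (subst (_≤ 2 * p) (sym (+-assoc p 1 s))
    (+-monoʳ-≤ p (≤-trans s<p (m≤m+n p 0)))))

f-lower : ∀ {p q s t R} → s + q ≡ p → 1 ≤ s → t ≤ p → LowerBounds p q t R → f p s t ≤ R
f-lower {p} {q} {s} {t} s+q≡p 1≤s t≤p lower with 2 * t ≤? p ∸ s + 1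
... | yes _ = z≤n
... | no 2t≰q+1 with 2 * t ≤? p + s ∸ 2
...   | yes 2t≤p+s-2 = lower-middle {q = q} {s} s+q≡p q≤2t (≤∸⇒+≤ 2≤p+s 2t≤p+s-2) lower
  where
  q≤2t : q ≤ 2 * t
  q≤2t = ≤-trans (m≤m+n q 1) (<⇒≤ (subst (λ n → n + 1 < 2 * t) p∸s≡q (≰⇒> 2t≰q+1)))
    where
    p∸s≡q : p ∸ s ≡ q
    p∸s≡q = trans (cong (_∸ s) (sym s+q≡p)) (m+n∸m≡n s q)
  2≤p+s : 2 ≤ p + s
  2≤p+s = subst (2 ≤_) (+-comm s p) (+-mono-≤ 1≤s (subst (1 ≤_) s+q≡p (≤-trans 1≤s (m≤m+n s q))))
...   | no 2t≰p+s-2 = lower-large {q = q} {s} s+q≡p p≤2t t≤p lower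
  where
  p≤2t : p ≤ 2 * t
  p≤2t = s≤s⁻¹ (s≤s⁻¹ (begin-strict
    1 + p    ≤⟨ +-monoˡ-≤ p 1≤s ⟩
    s + p    ≡⟨ +-comm s p ⟩
    p + s    <⟨ ∸<⇒<+ (≰⇒> 2t≰p+s-2) ⟩
    2 + 2 * t ∎))
    where open ≤-Reasoning

-- Counting triples

sum-allFin : ∀ n (h : Fin n → ℕ) → ListAction.sum (List.map h (allFin n)) ≡ sum h
sum-allFin n h = trans (cong ListAction.sum (map-tabulate id h)) (sum-tabulate h)
  where
  sum-tabulate : ∀ {n} (h : Fin n → ℕ) → ListAction.sum (tabulate h) ≡ sum h
  sum-tabulate {zero}  h = refl
  sum-tabulate {suc n} h = cong (h zero +_) (sum-tabulate (h ∘ suc))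

∣∣≡count : ∀ {n} (A : Subset n) → ∣ A ∣ ≡ count (lookup A)
∣∣≡count Vec.[]          = refl
∣∣≡count (true Vec.∷ A)  = cong suc (∣∣≡count A)
∣∣≡count (false Vec.∷ A) = ∣∣≡count A

module Triples (p : ℕ) .{{_ : NonZero p}} (p-prime : Prime p) where
  open ℤ/pℤ p
  open DifferenceCounts p
  open Pollard p p-prime

  r≡sum-ν : ∀ (A B C : Subset p) → r A B C ≡ sum (λ a → ind (lookup A a) * ν (lookup C) (lookup B) a)
  r≡sum-ν A B C = trans (sum-allFin p _) (sum-cong-≗ (λ a → trans (sum-allFin p _)
    (trans (sum-cong-≗ (λ b → *-assoc (ind (lookup A a)) (ind (lookup B b)) (ind (lookup C (a +ₚ b)))))
      (sym (*-distribˡ-sum (ind (lookup A a)) (λ b → ind (lookup B b) * ind (lookup C (a +ₚ b))))))))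

  module _ {B : Fin p → Bool} {j k : ℕ} (j≤B : j ≤ count B) (j+k≡ : j + k ≡ 2 * count B) (k≤p : k ≤ p) where

    pollard-BB : j * k ≤ sum (λ x → j ⊓ ν B B x)
    pollard-BB = pollard B B j k j≤B j≤B (trans j+k≡ (cong (count B +_) (+-identityʳ (count B)))) k≤p

    sum-ν-upper : ∀ X → sum (λ a → ind (X a) * ν B B a) + j * k ≤ count X * j + count B * count B
    sum-ν-upper X = begin
      sum (λ a → ind (X a) * ν B B a) + j * k
        ≤⟨ +-monoʳ-≤ _ pollard-BB ⟩
      sum (λ a → ind (X a) * ν B B a) + sum (λ a → j ⊓ ν B B a)
        ≡⟨ ∑-distrib-+ (λ a → ind (X a) * ν B B a) (λ a → j ⊓ ν B B a) ⟨
      sum (λ a → ind (X a) * ν B B a + j ⊓ ν B B a)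
        ≤⟨ sum-mono-≤ (λ a → pointwise (X a) (ν B B a)) ⟩
      sum (λ a → ind (X a) * j + ν B B a)
        ≡⟨ ∑-distrib-+ (λ a → ind (X a) * j) (ν B B) ⟩
      sum (λ a → ind (X a) * j) + sum (ν B B)
        ≡⟨ cong₂ _+_ (*-distribʳ-sum j (ind ∘ X)) (sym (sum-ν B B)) ⟨
      count X * j + count B * count B
        ∎
      where
      open ≤-Reasoning
      pointwise : ∀ x n → ind x * n + j ⊓ n ≤ ind x * j + n
      pointwise true  n = subst₂ _≤_ (cong (_+ j ⊓ n) (sym (*-identityˡ n)))
        (trans (+-comm n j) (cong (_+ n) (sym (*-identityˡ j)))) (+-monoʳ-≤ n (m⊓n≤m j n))
      pointwise false n = m⊓n≤n j n

    sum-ν-lower : ∀ X → j * k ≤ sum (λ a → ind (X a) * ν B B a) + count (not ∘ X) * j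
    sum-ν-lower X = begin
      j * k
        ≤⟨ pollard-BB ⟩
      sum (λ a → j ⊓ ν B B a)
        ≤⟨ sum-mono-≤ (λ a → pointwise (X a) (ν B B a)) ⟩
      sum (λ a → ind (X a) * ν B B a + ind (not (X a)) * j)
        ≡⟨ ∑-distrib-+ (λ a → ind (X a) * ν B B a) (λ a → ind (not (X a)) * j) ⟩
      sum (λ a → ind (X a) * ν B B a) + sum (λ a → ind (not (X a)) * j)
        ≡⟨ cong (sum (λ a → ind (X a) * ν B B a) +_) (*-distribʳ-sum j (ind ∘ not ∘ X)) ⟨
      sum (λ a → ind (X a) * ν B B a) + count (not ∘ X) * j
        ∎
      where
      open ≤-Reasoning
      pointwise : ∀ x n → j ⊓ n ≤ ind x * n + ind (not x) * j
      pointwise true  n = subst (j ⊓ n ≤_) (sym (trans (+-identityʳ (1 * n)) (*-identityˡ n))) (m⊓n≤n j n)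
      pointwise false n = subst (j ⊓ n ≤_) (sym (*-identityˡ j)) (m⊓n≤m j n)

  r-upper : ∀ A B → UpperBounds p ∣ A ∣ ∣ B ∣ (r A B B)
  r-upper A B rewrite r≡sum-ν A B B | ∣∣≡count A | ∣∣≡count B =
    λ j k j≤t j+k≡ k≤p → sum-ν-upper j≤t j+k≡ k≤p (lookup A)

  r-lower : ∀ A B → LowerBounds p (count (not ∘ lookup A)) ∣ B ∣ (r A B B)
  r-lower A B rewrite r≡sum-ν A B B | ∣∣≡count B =
    λ j k j≤t j+k≡ k≤p → sum-ν-lower j≤t j+k≡ k≤p (lookup A)

theorem6 : (p : ℕ) .{{_ : NonZero p}} → Prime p → ¬ (2 ∣ p) →
    (s t : ℕ) → 1 ≤ s → s ≤ p ∸ 1 → 1 ≤ t → t ≤ p ∸ 1 →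
    (A B : Subset p) → ∣ A ∣ ≡ s → ∣ B ∣ ≡ t →
    (f p s t ≤ r A B B) × (r A B B ≤ g p s t)
theorem6 p p-prime _ _ _ 1≤s s≤p-1 _ t≤p-1 A B refl refl =
  f-lower s+q≡p 1≤s t≤p (r-lower A B) , g-upper s<p t≤p (r-upper A B)
  where
  open Triples p p-prime
  p-1<p : p ∸ 1 < p
  p-1<p = ∸-monoʳ-< {p} {1} {0} (s≤s z≤n) (>-nonZero⁻¹ p)
  s<p = ≤-<-trans s≤p-1 p-1<p
  t≤p = <⇒≤ (≤-<-trans t≤p-1 p-1<p)
  s+q≡p : ∣ A ∣ + count (not ∘ lookup A) ≡ p
  s+q≡p = trans (cong (_+ count (not ∘ lookup A)) (∣∣≡count A)) (count-complement (lookup A))
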